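{- Let $X$ and $Y$ be types equipped with operators $\mathrm{int}_X$, $\mathrm{int}_Y$, let $f:X\to Y$ be a function and $s:\mathcal P(X)$. Then $!\,\mathbf{Conti}(f)\multimap\mathbf{Cpt}_X(s)\multimap\mathbf{Cpt}_Y(f(s)).$
   Context: Framework: constructive mathematics with affine logic as internal logic (classical linear logic with weakening but without contraction). Connectives: $\otimes$ (multiplicative conjunction, unit $\top$), $\mathbin{\mathrm{par}}$ (multiplicative disjunction), $\mathbin{\&}$ (additive conjunction), $\oplus$ (additive disjunction), involutive negation $\neg$, $\multimap$ (right associative), exponentials $!,?$; $\forall,\exists$ usual (additive) quantifiers; $\otimes,\mathbin{\&}$ bind tighter than $\mathbin{\mathrm{par}},\oplus,\multimap$. $\Omega$ is the impredicative type of propositions, $\mathcal P(X):=X\to\Omega$, $x\in s$ means $s(x)$, $x\notin s$ means $\neg s(x)$, $s\subseteq t:=\forall x,(x\in s\multimap x\in t)$, $s^{\mathsf c}:=\{x\mid x\notin s\}$, $s\boxtimes t:=\{x\mid x\in s\otimes x\in t\}$, $X$ also denotes $\{x\mid\top\}$. For a type $Z$ with operator $\mathrm{int}$: closure $\mathrm{cl}\,s:=(\mathrm{int}(s^{\mathsf c}))^{\mathsf c}$; filter $\mathbf{Fil}(\mathcal F):=\,!\big((\forall s,t,(s\in\mathcal F\multimap s\subseteq t\multimap t\in\mathcal F))\otimes Z\in\mathcal F\otimes\forall s,t,(s\in\mathcal F\otimes t\in\mathcal F\multimap s\boxtimes t\in\mathcal F)\big)$; compactness $\mathbf{Cpt}_Z(s):=\forall\mathcal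 F:\mathcal P(\mathcal P(Z)),\ \mathbf{Fil}(\mathcal F)\multimap s^{\mathsf c}\notin\mathcal F\multimap\exists z:Z,\big(z\in s\otimes\,!\forall t:\mathcal P(Z),(t\in\mathcal F\multimap z\in\mathrm{cl}\,t)\big)$. For $f:X\to Y$: inverse image $f^{ -1}(t):=t\circ f$ for $t:\mathcal P(Y)$; image (impredicative) $f(s):=\{y:Y\mid\forall t:\mathcal P(Y),(s\subseteq f^{ -1}(t)\multimap y\in t)\}$ for $s:\mathcal P(X)$; continuity $\mathbf{Conti}(f):=\forall t:\mathcal P(Y),\ f^{ -1}(\mathrm{int}_Y t)\subseteq\mathrm{int}_X f^{ -1}(t)$. -}

module Defs where

open import Level using (Level; suc; Lift; lift)
open import Data.Bool using (Bool; true; false)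
open import Data.Product using (_×_)

-- Algebraic (truth-value) semantics of the framework's internal logic:
-- classical affine logic = commutative, residuated, complete lattice
-- whose multiplicative unit is the top element (weakening), with an
-- involutive negation (classical) and a storage modality ! .
-- Quantifiers are indexed over arbitrary types in the universe Set ℓ
-- which also contains Ω itself (impredicativity).
record AffineLogic (ℓ : Level) : Set (suc ℓ) where
  infix  4 _≤_
  infixr 7 _⊗_
  infixr 5 _⊸_
  infix  9 !_
  field
    Ω     : Set ℓ
    _≤_   : Ω → Ω → Set ℓ
    ≤-refl  : ∀ {a} → a ≤ a
    ≤-trans : ∀ {a b c} → a ≤ b → b ≤ c → a ≤ c
    _⊗_   : Ω → Ω → Ω
    𝟙     : Ω
    ⊗-comm   : ∀ {a b} → a ⊗ b ≤ b ⊗ a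
    ⊗-assocˡ : ∀ {a b c} → (a ⊗ b) ⊗ c ≤ a ⊗ (b ⊗ c)
    ⊗-assocʳ : ∀ {a b c} → a ⊗ (b ⊗ c) ≤ (a ⊗ b) ⊗ c
    ⊗-unitˡ  : ∀ {a} → a ⊗ 𝟙 ≤ a
    ⊗-unitʳ  : ∀ {a} → a ≤ a ⊗ 𝟙
    𝟙-top : ∀ {a} → a ≤ 𝟙
    _⊸_   : Ω → Ω → Ω
    curry   : ∀ {a b c} → a ⊗ b ≤ c → a ≤ b ⊸ c
    uncurry : ∀ {a b c} → a ≤ b ⊸ c → a ⊗ b ≤ c
    𝟘     : Ω
    𝟘-bot : ∀ {a} → 𝟘 ≤ a
    ¬¬-elim : ∀ {a} → (a ⊸ 𝟘) ⊸ 𝟘 ≤ a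
    ⋀     : {I : Set ℓ} → (I → Ω) → Ω
    ⋀-lb  : ∀ {I : Set ℓ} {f : I → Ω} (i : I) → ⋀ f ≤ f i
    ⋀-glb : ∀ {I : Set ℓ} {f : I → Ω} {a} → (∀ i → a ≤ f i) → a ≤ ⋀ f
    ⋁     : {I : Set ℓ} → (I → Ω) → Ω
    ⋁-ub  : ∀ {I : Set ℓ} {f : I → Ω} (i : I) → f i ≤ ⋁ f
    ⋁-lub : ∀ {I : Set ℓ} {f : I → Ω} {a} → (∀ i → f i ≤ a) → ⋁ f ≤ a
    !_      : Ω → Ω
    !-mono  : ∀ {a b} → a ≤ b → ! a ≤ ! b
    !-der   : ∀ {a} → ! a ≤ a
    !-dig   : ∀ {a} → ! a ≤ ! ! a
    !-𝟙     : 𝟙 ≤ ! 𝟙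
    !-&ˡ    : ∀ {a b} → ! (⋀ {Lift ℓ Bool} (λ { (lift true) → a ; (lift false) → b }))
                          ≤ ! a ⊗ ! b
    !-&ʳ    : ∀ {a b} → ! a ⊗ ! b
                          ≤ ! (⋀ {Lift ℓ Bool} (λ { (lift true) → a ; (lift false) → b }))

module Logic {ℓ : Level} (L : AffineLogic ℓ) where
  open AffineLogic L public

  infixr 7 _&_
  infixr 5 _⅋_ _⊕_
  infix  9 ¬_ ⁇_

  ¬_ : Ω → Ω
  ¬ a = a ⊸ 𝟘

  _&_ : Ω → Ω → Ω
  a & b = ⋀ {Lift ℓ Bool} (λ { (lift true) → a ; (lift false) → b })

  _⊕_ : Ω → Ω → Ω
  a ⊕ b = ⋁ {Lift ℓ Bool} (λ { (lift true) → a ; (lift false) → b })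

  _⅋_ : Ω → Ω → Ω
  a ⅋ b = ¬ (¬ a ⊗ ¬ b)

  ⁇_ : Ω → Ω
  ⁇ a = ¬ ! ¬ a

  Forall : (A : Set ℓ) → (A → Ω) → Ω
  Forall A φ = ⋀ φ

  Exists : (A : Set ℓ) → (A → Ω) → Ω
  Exists A φ = ⋁ φ

  Valid : Ω → Set ℓ
  Valid φ = 𝟙 ≤ φ

  𝓟 : Set ℓ → Set ℓ
  𝓟 X = X → Ω

  _∈_ : {X : Set ℓ} → X → 𝓟 X → Ω
  x ∈ s = s x

  _∉_ : {X : Set ℓ} → X → 𝓟 X → Ω
  x ∉ s = ¬ (s x)

  _⊆_ : {X : Set ℓ} → 𝓟 X → 𝓟 X → Ω
  _⊆_ {X} s t = Forall X (λ x → x ∈ s ⊸ x ∈ t)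

  _ᶜ : {X : Set ℓ} → 𝓟 X → 𝓟 X
  (s ᶜ) x = x ∉ s

  _⊠_ : {X : Set ℓ} → 𝓟 X → 𝓟 X → 𝓟 X
  (s ⊠ t) x = x ∈ s ⊗ x ∈ t

  full : (X : Set ℓ) → 𝓟 X
  full X x = 𝟙

  cl : {Z : Set ℓ} → (𝓟 Z → 𝓟 Z) → 𝓟 Z → 𝓟 Z
  cl int s = (int (s ᶜ)) ᶜ

  Fil : {Z : Set ℓ} → 𝓟 (𝓟 Z) → Ω
  Fil {Z} F = ! ( Forall (𝓟 Z) (λ s → Forall (𝓟 Z) (λ t → s ∈ F ⊸ s ⊆ t ⊸ t ∈ F))
                ⊗ full Z ∈ F
                ⊗ Forall (𝓟 Z) (λ s → Forall (𝓟 Z) (λ t → s ∈ F ⊗ t ∈ F ⊸ (s ⊠ t) ∈ F)))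

  Cpt : {Z : Set ℓ} → (𝓟 Z → 𝓟 Z) → 𝓟 Z → Ω
  Cpt {Z} int s =
    Forall (𝓟 (𝓟 Z)) (λ F → Fil F ⊸ (s ᶜ) ∉ F ⊸
      Exists Z (λ z → z ∈ s ⊗ ! Forall (𝓟 Z) (λ t → t ∈ F ⊸ z ∈ cl int t)))

  preimage : {X Y : Set ℓ} → (X → Y) → 𝓟 Y → 𝓟 X
  preimage f t x = t (f x)

  image : {X Y : Set ℓ} → (X → Y) → 𝓟 X → 𝓟 Y
  image {X} {Y} f s y = Forall (𝓟 Y) (λ t → s ⊆ preimage f t ⊸ y ∈ t)

  Conti : {X Y : Set ℓ} → (𝓟 X → 𝓟 X) → (𝓟 Y → 𝓟 Y) → (X → Y) → Ω
  Conti {X} {Y} intX intY f =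
    Forall (𝓟 Y) (λ t → preimage f (intY t) ⊆ intX (preimage f t))

{-# OPTIONS --safe #-}
-- Pull a filter G on Y back along f to F = {u | ∃ t ∈ G, f⁻¹ t ⊆ u}. It is a
-- filter, and it avoids sᶜ because f⁻¹ t ⊆ sᶜ forces t ⊆ f(s)ᶜ. Compactness of s
-- yields a cluster point x ∈ s of F, and continuity, in the form
-- cl (f⁻¹ t) ⊆ f⁻¹ (cl t), makes f x ∈ f(s) a cluster point of G.
module Submission where

open import Level using (Level; lift)
open import Data.Bool using (true; false)
open import Data.Product using (_×_; _,_)
open import Defs

module _ {ℓ : Level} (L : AffineLogic ℓ) where
  open Logic L

  infixr 4 _⨾_

  _⨾_ : ∀ {a b c} → a ≤ b → b ≤ c → a ≤ c
  _⨾_ = ≤-trans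

  ⊗-monoˡ : ∀ {a b c} → a ≤ b → a ⊗ c ≤ b ⊗ c
  ⊗-monoˡ p = uncurry (p ⨾ curry ≤-refl)

  ⊗-monoʳ : ∀ {a b c} → a ≤ b → c ⊗ a ≤ c ⊗ b
  ⊗-monoʳ p = ⊗-comm ⨾ ⊗-monoˡ p ⨾ ⊗-comm

  ⊗-mono : ∀ {a b c d} → a ≤ b → c ≤ d → a ⊗ c ≤ b ⊗ d
  ⊗-mono p q = ⊗-monoˡ p ⨾ ⊗-monoʳ q

  ⊗-projˡ : ∀ {a b} → a ⊗ b ≤ a
  ⊗-projˡ = ⊗-monoʳ 𝟙-top ⨾ ⊗-unitˡ

  ⊗-projʳ : ∀ {a b} → a ⊗ b ≤ b
  ⊗-projʳ = ⊗-comm ⨾ ⊗-projˡ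

  ⊗-interchange : ∀ {a b c d} → (a ⊗ b) ⊗ (c ⊗ d) ≤ (a ⊗ c) ⊗ (b ⊗ d)
  ⊗-interchange = ⊗-assocˡ ⨾ ⊗-monoʳ (⊗-assocʳ ⨾ ⊗-monoˡ ⊗-comm ⨾ ⊗-assocˡ) ⨾ ⊗-assocʳ

  ⊸-eval : ∀ {a b} → (a ⊸ b) ⊗ a ≤ b
  ⊸-eval = uncurry ≤-refl

  ⊸-eval₂ : ∀ {a b c} → (a ⊸ b ⊸ c) ⊗ (a ⊗ b) ≤ c
  ⊸-eval₂ = ⊗-assocʳ ⨾ ⊗-monoˡ ⊸-eval ⨾ ⊸-eval

  valid-curry₂ : ∀ {a b c} → a ⊗ b ≤ c → Valid (a ⊸ b ⊸ c)
  valid-curry₂ p = curry (curry (⊗-monoˡ ⊗-projʳ ⨾ p))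

  contrapose : ∀ {a b c} → a ⊗ b ≤ c → a ⊗ ¬ c ≤ ¬ b
  contrapose p = curry (⊗-assocˡ ⨾ ⊗-monoʳ ⊗-comm ⨾ ⊗-assocʳ ⨾ ⊗-monoˡ p ⨾ ⊗-comm ⨾ ⊸-eval)

  ⋀-mono : ∀ {I : Set ℓ} {f g : I → Ω} → (∀ i → f i ≤ g i) → ⋀ f ≤ ⋀ g
  ⋀-mono p = ⋀-glb λ i → ⋀-lb i ⨾ p i

  ⋁-elimˡ : ∀ {I : Set ℓ} {f : I → Ω} {a c} → (∀ i → f i ⊗ a ≤ c) → ⋁ f ⊗ a ≤ c
  ⋁-elimˡ p = uncurry (⋁-lub (λ i → curry (p i)))

  ⋁-elimʳ : ∀ {I : Set ℓ} {f : I → Ω} {a c} → (∀ i → a ⊗ f i ≤ c) → a ⊗ ⋁ f ≤ c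
  ⋁-elimʳ p = ⊗-comm ⨾ ⋁-elimˡ (λ i → ⊗-comm ⨾ p i)

  ⋁-⊗ : ∀ {I J : Set ℓ} {f : I → Ω} {g : J → Ω} →
        ⋁ f ⊗ ⋁ g ≤ ⋁ {I × J} (λ { (i , j) → f i ⊗ g j })
  ⋁-⊗ = ⋁-elimˡ λ i → ⋁-elimʳ λ j → ⋁-ub (i , j)

  !-contract : ∀ {a} → ! a ≤ ! a ⊗ ! a
  !-contract {a} = !-mono (⋀-glb λ { (lift true) → ≤-refl ; (lift false) → ≤-refl }) ⨾ !-&ˡ {a} {a}

  -- !-&ʳ and !-&ˡ spell a & b with distinct pattern lambdas, which are not definitionally
  -- equal, so ⋀-mono converts between them.
  !-⊗ : ∀ {a b} → ! a ⊗ ! b ≤ ! (a ⊗ b)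
  !-⊗ {a} {b} = !-&ʳ ⨾ !-dig ⨾
    !-mono (!-mono (⋀-mono λ { (lift true) → ≤-refl ; (lift false) → ≤-refl }) ⨾
            !-&ˡ {a} {b} ⨾ ⊗-mono !-der !-der)

  module _ {Z : Set ℓ} where

    ⊆-refl : ∀ {a : 𝓟 Z} → Valid (a ⊆ a)
    ⊆-refl = ⋀-glb λ z → curry ⊗-projʳ

    ⊆-trans : ∀ {a b c : 𝓟 Z} → (a ⊆ b) ⊗ (b ⊆ c) ≤ a ⊆ c
    ⊆-trans = ⋀-glb λ z → curry (⊗-monoˡ (⊗-mono (⋀-lb z) (⋀-lb z)) ⨾
      ⊗-monoˡ ⊗-comm ⨾ ⊗-assocˡ ⨾ ⊗-monoʳ ⊸-eval ⨾ ⊸-eval)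

    ⊠-mono : ∀ {a b c d : 𝓟 Z} → (a ⊆ b) ⊗ (c ⊆ d) ≤ (a ⊠ c) ⊆ (b ⊠ d)
    ⊠-mono = ⋀-glb λ z → curry (⊗-monoˡ (⊗-mono (⋀-lb z) (⋀-lb z)) ⨾
      ⊗-interchange ⨾ ⊗-mono ⊸-eval ⊸-eval)

    ⊆ᶜ-swap : ∀ {a b : 𝓟 Z} → a ⊆ (b ᶜ) ≤ b ⊆ (a ᶜ)
    ⊆ᶜ-swap = ⋀-glb λ z → curry (curry (⊗-monoˡ (⊗-monoˡ (⋀-lb z)) ⨾
      ⊗-assocˡ ⨾ ⊗-monoʳ ⊗-comm ⨾ ⊗-assocʳ ⨾ ⊗-monoˡ ⊸-eval ⨾ ⊸-eval))

    Upward : 𝓟 (𝓟 Z) → Ω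
    Upward F = Forall (𝓟 Z) (λ u → Forall (𝓟 Z) (λ v → u ∈ F ⊸ u ⊆ v ⊸ v ∈ F))

    MeetClosed : 𝓟 (𝓟 Z) → Ω
    MeetClosed F = Forall (𝓟 Z) (λ u → Forall (𝓟 Z) (λ v → u ∈ F ⊗ v ∈ F ⊸ (u ⊠ v) ∈ F))

    Upward-∈ : ∀ {F : 𝓟 (𝓟 Z)} {u v} → Upward F ⊗ (u ∈ F ⊗ u ⊆ v) ≤ v ∈ F
    Upward-∈ {u = u} {v} = ⊗-monoˡ (⋀-lb u ⨾ ⋀-lb v) ⨾ ⊸-eval₂

    ClusterPoint : (𝓟 Z → 𝓟 Z) → 𝓟 (𝓟 Z) → Z → Ω
    ClusterPoint int F z = Forall (𝓟 Z) (λ t → t ∈ F ⊸ z ∈ cl int t)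

  module _ {X Y : Set ℓ} (f : X → Y) where

    ∈-image : ∀ {s : 𝓟 X} {x} → x ∈ s ≤ f x ∈ image f s
    ∈-image {x = x} = ⋀-glb λ t → curry (⊗-comm ⨾ ⊗-monoˡ (⋀-lb x) ⨾ ⊸-eval)

    image-⊆ : ∀ {s : 𝓟 X} {t} → s ⊆ preimage f t ≤ image f s ⊆ t
    image-⊆ {t = t} = ⋀-glb λ y → curry (⊗-comm ⨾ ⊗-monoˡ (⋀-lb t) ⨾ ⊸-eval)

    preimage-⊆ᶜ : ∀ {s : 𝓟 X} {t} → preimage f t ⊆ (s ᶜ) ≤ t ⊆ (image f s ᶜ)
    preimage-⊆ᶜ = ⊆ᶜ-swap ⨾ image-⊆ ⨾ ⊆ᶜ-swap

    comap : 𝓟 (𝓟 Y) → 𝓟 (𝓟 X)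
    comap G u = Exists (𝓟 Y) (λ t → t ∈ G ⊗ preimage f t ⊆ u)

    module _ {G : 𝓟 (𝓟 Y)} where

      preimage-∈-comap : ∀ {t} → t ∈ G ≤ preimage f t ∈ comap G
      preimage-∈-comap {t} = ⊗-unitʳ ⨾ ⊗-monoʳ ⊆-refl ⨾ ⋁-ub t

      comap-upward : Valid (Upward (comap G))
      comap-upward = ⋀-glb λ u → ⋀-glb λ v → curry (curry (⊗-monoˡ ⊗-projʳ ⨾
        ⋁-elimˡ λ t → ⊗-assocˡ ⨾ ⊗-monoʳ ⊆-trans ⨾ ⋁-ub t))

      comap-meetClosed : MeetClosed G ≤ MeetClosed (comap G)
      comap-meetClosed = ⋀-glb λ u → ⋀-glb λ v → curry (⊗-monoʳ ⋁-⊗ ⨾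
        ⋁-elimʳ λ { (t₁ , t₂) → ⊗-monoʳ ⊗-interchange ⨾ ⊗-assocʳ ⨾
          ⊗-mono (⊗-monoˡ (⋀-lb t₁ ⨾ ⋀-lb t₂) ⨾ ⊸-eval) ⊠-mono ⨾ ⋁-ub (t₁ ⊠ t₂) })

      Fil-comap : Fil G ≤ Fil (comap G)
      Fil-comap = !-mono (⊗-mono (𝟙-top ⨾ comap-upward)
                                 (⊗-mono (preimage-∈-comap {full Y}) comap-meetClosed))

      comap-ᶜ : ∀ {s : 𝓟 X} → Upward G ⊗ (s ᶜ) ∈ comap G ≤ (image f s ᶜ) ∈ G
      comap-ᶜ = ⋁-elimʳ λ t → ⊗-monoʳ (⊗-monoʳ preimage-⊆ᶜ) ⨾ Upward-∈

      Fil-comap-avoiding : ∀ {s : 𝓟 X} →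
        Fil G ⊗ (image f s ᶜ) ∉ G ≤ Fil (comap G) ⊗ (s ᶜ) ∉ comap G
      Fil-comap-avoiding = ⊗-monoˡ (!-contract ⨾ ⊗-mono Fil-comap (!-der ⨾ ⊗-projˡ)) ⨾
                           ⊗-assocˡ ⨾ ⊗-monoʳ (contrapose comap-ᶜ)

    module _ {intX : 𝓟 X → 𝓟 X} {intY : 𝓟 Y → 𝓟 Y} where

      -- Since (f⁻¹ t)ᶜ is f⁻¹ (tᶜ) definitionally, this is continuity at tᶜ, contraposed.
      Conti-cl : ∀ {x t} → Conti intX intY f ⊗ x ∈ cl intX (preimage f t) ≤ f x ∈ cl intY t
      Conti-cl {x} {t} = contrapose (⊗-monoˡ (⋀-lb (t ᶜ) ⨾ ⋀-lb x) ⨾ ⊸-eval)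

      Conti-ClusterPoint : ∀ {G x} →
        Conti intX intY f ⊗ ClusterPoint intX (comap G) x ≤ ClusterPoint intY G (f x)
      Conti-ClusterPoint = ⋀-glb λ t → curry (⊗-assocˡ ⨾
        ⊗-monoʳ (⊗-mono (⋀-lb (preimage f t)) preimage-∈-comap ⨾ ⊸-eval) ⨾ Conti-cl)

      image-ClusterPoint : ∀ {G s} →
        ! Conti intX intY f ⊗ Exists X (λ x → x ∈ s ⊗ ! ClusterPoint intX (comap G) x)
          ≤ Exists Y (λ y → y ∈ image f s ⊗ ! ClusterPoint intY G y)
      image-ClusterPoint = ⋁-elimʳ λ x → ⊗-monoʳ ⊗-comm ⨾ ⊗-assocʳ ⨾ ⊗-comm ⨾
        ⊗-mono ∈-image (!-⊗ ⨾ !-mono Conti-ClusterPoint) ⨾ ⋁-ub (f x)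

      Cpt-image : ∀ {s} → ! Conti intX intY f ⊗ Cpt intX s ≤ Cpt intY (image f s)
      Cpt-image = ⋀-glb λ G → curry (curry (⊗-assocˡ ⨾ ⊗-assocˡ ⨾
        ⊗-monoʳ (⊗-monoʳ Fil-comap-avoiding ⨾ ⊗-monoˡ (⋀-lb (comap G)) ⨾ ⊸-eval₂) ⨾
        image-ClusterPoint))

theorem22 : ∀ {ℓ : Level} (L : AffineLogic ℓ) (X Y : Set ℓ)
    (intX : Logic.𝓟 L X → Logic.𝓟 L X) (intY : Logic.𝓟 L Y → Logic.𝓟 L Y)
    (f : X → Y) (s : Logic.𝓟 L X) →
    Logic.Valid L
    (AffineLogic._⊸_ L (AffineLogic.!_ L (Logic.Conti L intX intY f))
    (AffineLogic._⊸_ L (Logic.Cpt L intX s) (Logic.Cpt L intY (Logic.image L f s))))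
theorem22 L X Y intX intY f s = valid-curry₂ L (Cpt-image L f {intX} {intY})
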